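{- For all nonnegative integers $n$ and $r$, let $F(n,r)=\sum_{k=-n}^{n}\binom{2n}{n-k}k^{2r}$. Then $$\nu_2(F(n,r))\geqslant 2n-\min\{\alpha(n),\alpha(r)\}.$$
   Context: $\nu_2(m)=\sup\{v\in\mathbb{N}: 2^v\mid m\}$ denotes the 2-adic order of an integer $m$ (so $\nu_2(0)=\infty$). For a nonnegative integer $m$, $\alpha(m)$ denotes the number of 1s in the binary expansion of $m$. The convention $0^0=1$ is used, so $F(n,0)=\sum_{k=-n}^n\binom{2n}{n-k}=2^{2n}$. -}

module Defs where

open import Data.Nat using (ℕ; zero; suc; _+_; _*_; _∸_; _^_; _⊓_)
open import Data.Nat.DivMod using (_/_; _%_)
open import Data.Nat.Divisibility using (_∣_)
open import Data.Nat.Combinatorics using (_C_)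
open import Data.List using (List; map; upTo)
open import Data.Nat.ListAction using (sum)

-- number of 1s in the binary expansion, computed with fuel (fuel ≥ m suffices)
binOnes : ℕ → ℕ → ℕ
binOnes zero    m = 0
binOnes (suc f) m = m % 2 + binOnes f (m / 2)

α : ℕ → ℕ
α m = binOnes m m

dist : ℕ → ℕ → ℕ
dist a b = (a ∸ b) + (b ∸ a)

-- F(n,r) = Σ_{k=-n}^{n} C(2n, n-k) k^{2r}; reindexed by j = n - k ∈ [0, 2n],
-- so k = n - j and k^{2r} = |n - j|^{2r}  (Agda's 0 ^ 0 = 1 matches the convention)
F : ℕ → ℕ → ℕ
F n r = sum (map (λ j → ((2 * n) C j) * (dist n j ^ (2 * r))) (upTo (suc (2 * n))))

-- ν₂(m) ≥ v  ⇔  2^v ∣ m  (ν₂(m) = sup{v : 2^v ∣ m}; the set is downward closed)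
ν₂≥ : ℕ → ℕ → Set
ν₂≥ m v = 2 ^ v ∣ m

-- Two bounds are proved and the better one is kept.
--
-- Writing T f x = f x + f (x + 1) = 2 f x + Δ f x, one has F(n,r) = (T²ⁿ x²ʳ)(-n).  Call f
-- (c,s)-divisible when 2^(m+c-s) divides every m-th difference of f.  This is kept by sums,
-- improves by one under 2· and under Δ, hence under T, and is additive under products by the
-- Leibniz rule.  The identity is (0,1)-divisible, and so is the square of any (0,1)-divisible
-- function, since Δ(f²) = Δf·(2f + Δf).  As x²ʳ is a product of α(r) iterated squares of x,
-- it is (0,α(r))-divisible, and 2^(2n-α(r)) divides F(n,r).
--
-- On the other hand F(n,r+1) = n² F(n,r) - 2n(2n-1) F(n-1,r) and α(n-1) + 1 = α(n) + ν₂(n),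
-- so induction on r gives 2^(2n) ∣ 2^α(n) F(n,r).

module Submission where

open import Defs
open import Data.Nat.Base as ℕ using (ℕ; zero; suc)
open import Data.Sum.Base using (inj₁; inj₂)
open import Relation.Binary.PropositionalEquality
open ≡-Reasoning

module _ where
  open import Data.Nat.Base using (_+_; _*_; _^_; _≤_; _<_; z≤n; s≤s)
  open import Data.Nat.Properties
  open import Data.Nat.DivMod using (_%_; _/_; m*n%n≡0; m*n/n≡m; [m+kn]%n≡m%n; +-distrib-/; m/n<m)
  open import Data.Nat.Divisibility using (_∣_; ∣-refl; ∣m⇒∣m*n; *-monoʳ-∣)
  open import Data.Nat.Induction using (<-rec)
  open import Data.Nat.Combinatorics using (_C_; k>n⇒nCk≡0; nC1≡n; nCk+nC[k+1]≡[n+1]C[k+1])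
  open import Data.Nat.Tactic.RingSolver using (solve-∀)

  [1+k]*[1+n]C[1+k]≡[1+n]*nCk : ∀ n k → suc k * (suc n C suc k) ≡ suc n * (n C k)
  [1+k]*[1+n]C[1+k]≡[1+n]*nCk zero zero = refl
  [1+k]*[1+n]C[1+k]≡[1+n]*nCk zero (suc k) = begin
    suc (suc k) * (1 C suc (suc k))
      ≡⟨ cong (suc (suc k) *_) (k>n⇒nCk≡0 {1} {suc (suc k)} (s≤s (s≤s z≤n))) ⟩
    suc (suc k) * 0
      ≡⟨ *-zeroʳ (suc (suc k)) ⟩
    0
      ≡⟨ cong (1 *_) (k>n⇒nCk≡0 {0} {suc k} (s≤s z≤n)) ⟨
    1 * (0 C suc k)
      ∎
  [1+k]*[1+n]C[1+k]≡[1+n]*nCk (suc n) zero = begin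
    1 * (suc (suc n) C 1) ≡⟨ *-identityˡ _ ⟩
    suc (suc n) C 1       ≡⟨ nC1≡n (suc (suc n)) ⟩
    suc (suc n)           ≡⟨ *-identityʳ (suc (suc n)) ⟨
    suc (suc n) * 1       ∎
  [1+k]*[1+n]C[1+k]≡[1+n]*nCk (suc n) (suc k) = begin
    suc (suc k) * (suc (suc n) C suc (suc k))
      ≡⟨ cong (suc (suc k) *_) (nCk+nC[k+1]≡[n+1]C[k+1] (suc n) (suc k)) ⟨
    suc (suc k) * (a + b)
      ≡⟨ split k a b ⟩
    a + suc k * a + suc (suc k) * b
      ≡⟨ cong₂ (λ u v → a + u + v) ([1+k]*[1+n]C[1+k]≡[1+n]*nCk n k)
                                   ([1+k]*[1+n]C[1+k]≡[1+n]*nCk n (suc k)) ⟩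
    a + suc n * (n C k) + suc n * (n C suc k)
      ≡⟨ +-assoc a _ _ ⟩
    a + (suc n * (n C k) + suc n * (n C suc k))
      ≡⟨ cong (a +_) (*-distribˡ-+ (suc n) (n C k) (n C suc k)) ⟨
    a + suc n * (n C k + n C suc k)
      ≡⟨ cong (λ z → a + suc n * z) (nCk+nC[k+1]≡[n+1]C[k+1] n k) ⟩
    a + suc n * a
      ≡⟨⟩
    suc (suc n) * a ∎
    where
    a b : ℕ
    a = suc n C suc k
    b = suc n C suc (suc k)
    split : ∀ k a b → suc (suc k) * (a + b) ≡ a + suc k * a + suc (suc k) * b
    split = solve-∀

  -- Binary digit sums

  data EvenOrOdd : ℕ → Set where
    even : ∀ q → EvenOrOdd (2 * q)
    odd  : ∀ q → EvenOrOdd (suc (2 * q))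

  even-or-odd : ∀ n → EvenOrOdd n
  even-or-odd zero = even 0
  even-or-odd (suc n) with even-or-odd n
  ... | even q = odd q
  ... | odd q  = subst EvenOrOdd (*-suc 2 q) (even (suc q))

  [2q]%2≡0 : ∀ q → 2 * q % 2 ≡ 0
  [2q]%2≡0 q = trans (cong (_% 2) (*-comm 2 q)) (m*n%n≡0 q 2)

  [2q]/2≡q : ∀ q → 2 * q / 2 ≡ q
  [2q]/2≡q q = trans (cong (_/ 2) (*-comm 2 q)) (m*n/n≡m q 2)

  [1+2q]%2≡1 : ∀ q → suc (2 * q) % 2 ≡ 1
  [1+2q]%2≡1 q = trans (cong (λ z → suc z % 2) (*-comm 2 q)) ([m+kn]%n≡m%n 1 q 2)

  [1+2q]/2≡q : ∀ q → suc (2 * q) / 2 ≡ q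
  [1+2q]/2≡q q = begin
    (1 + 2 * q) / 2     ≡⟨ cong (λ z → (1 + z) / 2) (*-comm 2 q) ⟩
    (1 + q * 2) / 2     ≡⟨ +-distrib-/ 1 (q * 2) (subst (λ z → 1 + z < 2) (sym (m*n%n≡0 q 2)) ≤-refl) ⟩
    1 / 2 + q * 2 / 2   ≡⟨ cong (1 / 2 +_) (m*n/n≡m q 2) ⟩
    q                   ∎

  m≤1+n⇒m/2≤n : ∀ {m n} → m ≤ suc n → m / 2 ≤ n
  m≤1+n⇒m/2≤n {zero}  _     = z≤n
  m≤1+n⇒m/2≤n {suc m} m≤1+n = ≤-pred (≤-trans (m/n<m (suc m) 2 (s≤s (s≤s z≤n))) m≤1+n)

  binOnes-fuel : ∀ {f g} m → m ≤ f → m ≤ g → binOnes f m ≡ binOnes g m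
  binOnes-fuel {zero}  {zero}  m       _   _   = refl
  binOnes-fuel {zero}  {suc g} zero    _   _   = binOnes-fuel {zero} {g} zero z≤n z≤n
  binOnes-fuel {suc f} {zero}  zero    _   _   = binOnes-fuel {f} {zero} zero z≤n z≤n
  binOnes-fuel {suc f} {suc g} m       m≤f m≤g =
    cong (m % 2 +_) (binOnes-fuel (m / 2) (m≤1+n⇒m/2≤n m≤f) (m≤1+n⇒m/2≤n m≤g))

  α-unfold : ∀ n → α n ≡ n % 2 + α (n / 2)
  α-unfold zero    = refl
  α-unfold (suc n) = cong (suc n % 2 +_) (binOnes-fuel {n} (suc n / 2) (m≤1+n⇒m/2≤n ≤-refl) ≤-refl)

  α[2q]≡αq : ∀ q → α (2 * q) ≡ α q
  α[2q]≡αq q = begin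
    α (2 * q)                       ≡⟨ α-unfold (2 * q) ⟩
    2 * q % 2 + α (2 * q / 2)       ≡⟨ cong₂ (λ u v → u + α v) ([2q]%2≡0 q) ([2q]/2≡q q) ⟩
    α q                             ∎

  α[1+2q]≡1+αq : ∀ q → α (suc (2 * q)) ≡ suc (α q)
  α[1+2q]≡1+αq q = begin
    α (suc (2 * q))                       ≡⟨ α-unfold (suc (2 * q)) ⟩
    suc (2 * q) % 2 + α (suc (2 * q) / 2) ≡⟨ cong₂ (λ u v → u + α v) ([1+2q]%2≡1 q) ([1+2q]/2≡q q) ⟩
    suc (α q)                             ∎

  2^[1+αn]∣2^α[1+n]*[1+n] : ∀ n → 2 ^ suc (α n) ∣ 2 ^ α (suc n) * suc n
  2^[1+αn]∣2^α[1+n]*[1+n] = <-rec _ step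
    where
    step : ∀ n → (∀ {m} → m < n → 2 ^ suc (α m) ∣ 2 ^ α (suc m) * suc m) →
           2 ^ suc (α n) ∣ 2 ^ α (suc n) * suc n
    step n rec with even-or-odd n
    ... | even q = subst (λ e → 2 ^ e ∣ 2 ^ α (suc (2 * q)) * suc (2 * q))
                         (trans (α[1+2q]≡1+αq q) (cong suc (sym (α[2q]≡αq q))))
                         (∣m⇒∣m*n (suc (2 * q)) ∣-refl)
    ... | odd q  = subst₂ (λ e x → 2 ^ e ∣ x) (cong suc (sym (α[1+2q]≡1+αq q))) doubled
                          (*-monoʳ-∣ 2 (rec q<1+2q))
      where
      q<1+2q : q < suc (2 * q)
      q<1+2q = s≤s (m≤n*m q 2)
      doubling : ∀ a m → 2 * (a * m) ≡ a * (2 * m)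
      doubling = solve-∀
      doubled : 2 * (2 ^ α (suc q) * suc q) ≡ 2 ^ α (suc (suc (2 * q))) * suc (suc (2 * q))
      doubled = begin
        2 * (2 ^ α (suc q) * suc q)     ≡⟨ doubling (2 ^ α (suc q)) (suc q) ⟩
        2 ^ α (suc q) * (2 * suc q)     ≡⟨ cong (λ e → 2 ^ e * (2 * suc q)) (α[2q]≡αq (suc q)) ⟨
        2 ^ α (2 * suc q) * (2 * suc q) ≡⟨ cong (λ m → 2 ^ α m * m) (*-suc 2 q) ⟩
        2 ^ α (suc (suc (2 * q))) * suc (suc (2 * q)) ∎

module _ where
  open import Data.List.Base using (map; applyUpTo)
  open import Data.Nat.ListAction using (sum)
  open import Function.Base using (id)
  open import Data.Integer.Base using (ℤ; +_; -_; _+_; _-_; _*_; _^_; ∣_∣; 0ℤ; 1ℤ)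
  import Data.Integer.Properties as ℤ
  import Data.Nat.Properties as ℕ
  open import Data.Nat.Divisibility using () renaming (_∣_ to _ℕ∣_)
  open import Data.Integer.Divisibility.Signed
    using (_∣_; divides; ∣⇒∣ᵤ; ∣-trans; ∣m∣n⇒∣m+n; *-monoʳ-∣; *-monoˡ-∣; *-cancelˡ-∣)
  open import Data.Integer.Tactic.RingSolver using (solve-∀)
  open import Data.Nat.Combinatorics using (_C_; k>n⇒nCk≡0; nCk+nC[k+1]≡[n+1]C[k+1])
  open import Data.Nat.DivMod using (m≡m%n+[m/n]*n; m%n<n)

  private variable
    c d s t : ℕ
    f g : ℤ → ℤ

  -- Finite differences and powers of two

  -- Opaque, so that the exponent in 2^ k is recovered by unification.
  opaque
    2^_ : ℕ → ℤ
    2^ k = + (2 ℕ.^ k)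

    2^-suc : ∀ k → 2^ suc k ≡ + 2 * 2^ k
    2^-suc k = ℤ.pos-* 2 (2 ℕ.^ k)

    2^-+ : ∀ a b → 2^ (a ℕ.+ b) ≡ 2^ a * 2^ b
    2^-+ a b = trans (cong +_ (ℕ.^-distribˡ-+-* 2 a b)) (ℤ.pos-* (2 ℕ.^ a) (2 ℕ.^ b))

    2^0∣ : ∀ x → 2^ 0 ∣ x
    2^0∣ x = divides x (sym (ℤ.*-identityʳ x))

    2^∣2^*+⇒∣ : ∀ {a b x} → 2^ a ∣ 2^ b * + x → 2 ℕ.^ a ℕ∣ 2 ℕ.^ b ℕ.* x
    2^∣2^*+⇒∣ {a} {b} {x} d = subst (2 ℕ.^ a ℕ∣_) (cong ∣_∣ (sym (ℤ.pos-* (2 ℕ.^ b) x))) (∣⇒∣ᵤ d)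

  2^∣-reindex : ∀ {a b x} → a ≡ b → 2^ a ∣ x → 2^ b ∣ x
  2^∣-reindex {x = x} = subst (λ e → 2^ e ∣ x)

  private
    ∣-respʳ : ∀ {k x y} → x ≡ y → k ∣ x → k ∣ y
    ∣-respʳ {k} = subst (k ∣_)

    ∣0ℤ : ∀ k → k ∣ 0ℤ
    ∣0ℤ k = divides 0ℤ (sym (ℤ.*-zeroˡ k))

    *-pres-∣ : ∀ {a b x y} → a ∣ x → b ∣ y → a * b ∣ x * y
    *-pres-∣ {a} {b} {x} {y} a∣x b∣y = ∣-trans (*-monoˡ-∣ b a∣x) (*-monoʳ-∣ x b∣y)

  2^[1+b]*x≡2*[2^b*x] : ∀ b x → 2^ suc b * x ≡ + 2 * (2^ b * x)
  2^[1+b]*x≡2*[2^b*x] b x = trans (cong (_* x) (2^-suc b)) (ℤ.*-assoc (+ 2) (2^ b) x)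

  2^∣2^*-double : ∀ {a b x} → 2^ a ∣ 2^ b * x → 2^ suc a ∣ 2^ suc b * x
  2^∣2^*-double {a} {b} {x} d =
    subst₂ _∣_ (sym (2^-suc a)) (sym (2^[1+b]*x≡2*[2^b*x] b x)) (*-monoʳ-∣ (+ 2) d)

  2^∣2^*-halve : ∀ {a b x} → 2^ suc a ∣ 2^ suc b * x → 2^ a ∣ 2^ b * x
  2^∣2^*-halve {a} {b} {x} d =
    *-cancelˡ-∣ (+ 2) (subst₂ _∣_ (2^-suc a) (2^[1+b]*x≡2*[2^b*x] b x) d)

  Δ : (ℤ → ℤ) → ℤ → ℤ
  Δ f x = f (x + 1ℤ) - f x

  Δ^ : ℕ → (ℤ → ℤ) → ℤ → ℤ
  Δ^ zero    f = f
  Δ^ (suc m) f = Δ^ m (Δ f)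

  Δ^-cong : ∀ m → (∀ x → f x ≡ g x) → ∀ a → Δ^ m f a ≡ Δ^ m g a
  Δ^-cong zero    f≗g a = f≗g a
  Δ^-cong (suc m) f≗g a = Δ^-cong m (λ x → cong₂ _-_ (f≗g (x + 1ℤ)) (f≗g x)) a

  Δ^-+ : ∀ m f g a → Δ^ m (λ x → f x + g x) a ≡ Δ^ m f a + Δ^ m g a
  Δ^-+ zero    f g a = refl
  Δ^-+ (suc m) f g a = trans (Δ^-cong m (λ x → Δ-+ (f (x + 1ℤ)) (f x) (g (x + 1ℤ)) (g x)) a)
                             (Δ^-+ m (Δ f) (Δ g) a)
    where
    Δ-+ : ∀ u v u′ v′ → (u + u′) - (v + v′) ≡ (u - v) + (u′ - v′)
    Δ-+ = solve-∀

  Δ^-*ˡ : ∀ m k f a → Δ^ m (λ x → k * f x) a ≡ k * Δ^ m f a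
  Δ^-*ˡ zero    k f a = refl
  Δ^-*ˡ (suc m) k f a = trans (Δ^-cong m (λ x → Δ-*ˡ k (f (x + 1ℤ)) (f x)) a) (Δ^-*ˡ m k (Δ f) a)
    where
    Δ-*ˡ : ∀ k u v → k * u - k * v ≡ k * (u - v)
    Δ-*ˡ = solve-∀

  Δ^-shift : ∀ m f a → Δ^ m (λ x → f (x + 1ℤ)) a ≡ Δ^ m f (a + 1ℤ)
  Δ^-shift zero    f a = refl
  Δ^-shift (suc m) f a = Δ^-shift m (Δ f) a

  Δ^-0 : ∀ m a → Δ^ m (λ _ → 0ℤ) a ≡ 0ℤ
  Δ^-0 zero    a = refl
  Δ^-0 (suc m) a = Δ^-0 m a

  -- (c,s)-divisibility, 2^(m+c-s) ∣ Δ^m f a, with 2^s moved to the right to avoid truncated subtraction.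
  record ΔDivisible (c s : ℕ) (f : ℤ → ℤ) : Set where
    field Δ^-divisible : ∀ m a → 2^ (m ℕ.+ c) ∣ 2^ s * Δ^ m f a
  open ΔDivisible

  ΔDivisible-cong : (∀ x → f x ≡ g x) → ΔDivisible c s f → ΔDivisible c s g
  ΔDivisible-cong f≗g F .Δ^-divisible m a =
    ∣-respʳ (cong (2^ _ *_) (Δ^-cong m f≗g a)) (F .Δ^-divisible m a)

  ΔDivisible-0 : ΔDivisible c s (λ _ → 0ℤ)
  ΔDivisible-0 {s = s} .Δ^-divisible m a =
    ∣-respʳ (sym (trans (cong (2^ s *_) (Δ^-0 m a)) (ℤ.*-zeroʳ (2^ s)))) (∣0ℤ _)

  ΔDivisible-+ : ΔDivisible c s f → ΔDivisible c s g → ΔDivisible c s (λ x → f x + g x)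
  ΔDivisible-+ {s = s} {f = f} {g = g} F G .Δ^-divisible m a =
    ∣-respʳ distrib (∣m∣n⇒∣m+n (F .Δ^-divisible m a) (G .Δ^-divisible m a))
    where
    distrib : 2^ s * Δ^ m f a + 2^ s * Δ^ m g a ≡ 2^ s * Δ^ m (λ x → f x + g x) a
    distrib = trans (sym (ℤ.*-distribˡ-+ (2^ s) _ _)) (cong (2^ s *_) (sym (Δ^-+ m f g a)))

  ΔDivisible-2* : ΔDivisible c s f → ΔDivisible (suc c) s (λ x → + 2 * f x)
  ΔDivisible-2* {c = c} {s = s} {f = f} F .Δ^-divisible m a =
    subst₂ _∣_ (trans (sym (2^-suc (m ℕ.+ c))) (cong 2^_ (sym (ℕ.+-suc m c)))) twice
      (*-monoʳ-∣ (+ 2) (F .Δ^-divisible m a))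
    where
    swap : ∀ x y z → x * (y * z) ≡ y * (x * z)
    swap = solve-∀
    twice : + 2 * (2^ s * Δ^ m f a) ≡ 2^ s * Δ^ m (λ x → + 2 * f x) a
    twice = trans (swap (+ 2) (2^ s) (Δ^ m f a)) (cong (2^ s *_) (sym (Δ^-*ˡ m (+ 2) f a)))

  ΔDivisible-Δ : ΔDivisible c s f → ΔDivisible (suc c) s (Δ f)
  ΔDivisible-Δ {c = c} F .Δ^-divisible m a = 2^∣-reindex (sym (ℕ.+-suc m c)) (F .Δ^-divisible (suc m) a)

  ΔDivisible-intro : (∀ a → 2^ c ∣ 2^ s * f a) → ΔDivisible (suc c) s (Δ f) → ΔDivisible c s f
  ΔDivisible-intro f∣ ΔF .Δ^-divisible zero    a = f∣ a
  ΔDivisible-intro {c = c} f∣ ΔF .Δ^-divisible (suc m) a = 2^∣-reindex (ℕ.+-suc m c) (ΔF .Δ^-divisible m a)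

  ΔDivisible-shift : ΔDivisible c s f → ΔDivisible c s (λ x → f (x + 1ℤ))
  ΔDivisible-shift {f = f} F .Δ^-divisible m a =
    ∣-respʳ (cong (2^ _ *_) (sym (Δ^-shift m f a))) (F .Δ^-divisible m (a + 1ℤ))

  ΔDivisible-double : ΔDivisible c s f → ΔDivisible (suc c) (suc s) f
  ΔDivisible-double {c = c} F .Δ^-divisible m a =
    2^∣-reindex (sym (ℕ.+-suc m c)) (2^∣2^*-double (F .Δ^-divisible m a))

  ΔDivisible-halve : ΔDivisible (suc c) (suc s) f → ΔDivisible c s f
  ΔDivisible-halve {c = c} F .Δ^-divisible m a =
    2^∣2^*-halve (2^∣-reindex (ℕ.+-suc m c) (F .Δ^-divisible m a))

  Δ^-leibniz : ∀ m → ΔDivisible c s f → ΔDivisible d t g →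
               ∀ a → 2^ (m ℕ.+ (c ℕ.+ d)) ∣ 2^ (s ℕ.+ t) * Δ^ m (λ x → f x * g x) a
  Δ^-leibniz {c = c} {s = s} {f = f} {d = d} {t = t} {g = g} zero F G a =
    subst₂ _∣_ (sym (2^-+ c d)) collect (*-pres-∣ (F .Δ^-divisible 0 a) (G .Δ^-divisible 0 a))
    where
    interchange : ∀ u x v y → (u * x) * (v * y) ≡ (u * v) * (x * y)
    interchange = solve-∀
    collect : (2^ s * f a) * (2^ t * g a) ≡ 2^ (s ℕ.+ t) * (f a * g a)
    collect = trans (interchange (2^ s) (f a) (2^ t) (g a)) (cong (_* (f a * g a)) (sym (2^-+ s t)))
  Δ^-leibniz {c = c} {s = s} {f = f} {d = d} {t = t} {g = g} (suc m) F G a =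
    subst (2^ suc (m ℕ.+ (c ℕ.+ d)) ∣_) collect (∣m∣n⇒∣m+n Δf*g Ef*Δg)
    where
    product-rule : ∀ u v u′ v′ → u * u′ - v * v′ ≡ (u - v) * v′ + u * (u′ - v′)
    product-rule = solve-∀
    Δf*g : 2^ suc (m ℕ.+ (c ℕ.+ d)) ∣ 2^ (s ℕ.+ t) * Δ^ m (λ x → Δ f x * g x) a
    Δf*g = 2^∣-reindex (ℕ.+-suc m (c ℕ.+ d)) (Δ^-leibniz m (ΔDivisible-Δ F) G a)
    Ef*Δg : 2^ suc (m ℕ.+ (c ℕ.+ d)) ∣ 2^ (s ℕ.+ t) * Δ^ m (λ x → f (x + 1ℤ) * Δ g x) a
    Ef*Δg = 2^∣-reindex (trans (cong (m ℕ.+_) (ℕ.+-suc c d)) (ℕ.+-suc m (c ℕ.+ d)))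
              (Δ^-leibniz m (ΔDivisible-shift F) (ΔDivisible-Δ G) a)
    collect : 2^ (s ℕ.+ t) * Δ^ m (λ x → Δ f x * g x) a
            + 2^ (s ℕ.+ t) * Δ^ m (λ x → f (x + 1ℤ) * Δ g x) a
            ≡ 2^ (s ℕ.+ t) * Δ^ (suc m) (λ x → f x * g x) a
    collect = trans (sym (ℤ.*-distribˡ-+ (2^ (s ℕ.+ t)) _ _)) (cong (2^ (s ℕ.+ t) *_)
      (trans (sym (Δ^-+ m _ _ a))
             (Δ^-cong m (λ x → sym (product-rule (f (x + 1ℤ)) (f x) (g (x + 1ℤ)) (g x))) a)))

  ΔDivisible-* : ΔDivisible c s f → ΔDivisible d t g → ΔDivisible (c ℕ.+ d) (s ℕ.+ t) (λ x → f x * g x)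
  ΔDivisible-* F G .Δ^-divisible m = Δ^-leibniz m F G

  ΔDivisible-1 : ΔDivisible 0 0 (λ _ → 1ℤ)
  ΔDivisible-1 = ΔDivisible-intro (λ _ → 2^0∣ _) ΔDivisible-0

  ΔDivisible-id : ΔDivisible 0 1 (λ x → x)
  ΔDivisible-id = ΔDivisible-intro (λ _ → 2^0∣ _)
    (ΔDivisible-cong (λ x → sym (Δid x)) (ΔDivisible-double ΔDivisible-1))
    where
    Δid : ∀ x → (x + 1ℤ) - x ≡ 1ℤ
    Δid = solve-∀

  ΔDivisible-square : ΔDivisible 0 1 f → ΔDivisible 0 1 (λ x → f x * f x)
  ΔDivisible-square {f = f} F = ΔDivisible-intro (λ _ → 2^0∣ _)
    (ΔDivisible-halve (ΔDivisible-cong Δ-square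
      (ΔDivisible-* (ΔDivisible-Δ F) (ΔDivisible-+ (ΔDivisible-2* F) (ΔDivisible-Δ F)))))
    where
    difference-of-squares : ∀ u v → (u - v) * (+ 2 * v + (u - v)) ≡ u * u - v * v
    difference-of-squares = solve-∀
    Δ-square : ∀ x → Δ f x * (+ 2 * f x + Δ f x) ≡ Δ (λ x → f x * f x) x
    Δ-square x = difference-of-squares (f (x + 1ℤ)) (f x)

  ^-by-squaring : ∀ x N → x ^ (N ℕ.% 2) * (x * x) ^ (N ℕ./ 2) ≡ x ^ N
  ^-by-squaring x N = begin
    x ^ (N ℕ.% 2) * (x * x) ^ (N ℕ./ 2)      ≡⟨ cong (x ^ (N ℕ.% 2) *_) (square-^ (N ℕ./ 2)) ⟩
    x ^ (N ℕ.% 2) * x ^ (N ℕ./ 2 ℕ.* 2)      ≡⟨ ℤ.^-distribˡ-+-* x (N ℕ.% 2) _ ⟨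
    x ^ (N ℕ.% 2 ℕ.+ N ℕ./ 2 ℕ.* 2)          ≡⟨ cong (x ^_) (m≡m%n+[m/n]*n N 2) ⟨
    x ^ N                                    ∎
    where
    square-^ : ∀ q → (x * x) ^ q ≡ x ^ (q ℕ.* 2)
    square-^ zero    = refl
    square-^ (suc q) = trans (cong ((x * x) *_) (square-^ q)) (ℤ.*-assoc x x _)

  ΔDivisible-^ : ∀ fuel {N} → N ℕ.≤ fuel → ΔDivisible 0 1 f →
                 ΔDivisible 0 (binOnes fuel N) (λ x → f x ^ N)
  ΔDivisible-^ zero       ℕ.z≤n F = ΔDivisible-1
  ΔDivisible-^ {f = f} (suc fuel) {N} N≤ F =
    ΔDivisible-cong (λ x → ^-by-squaring (f x) N)
      (ΔDivisible-* (last-digit (N ℕ.% 2) (m%n<n N 2))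
                    (ΔDivisible-^ fuel (m≤1+n⇒m/2≤n N≤) (ΔDivisible-square F)))
    where
    last-digit : ∀ b → b ℕ.< 2 → ΔDivisible 0 b (λ x → f x ^ b)
    last-digit 0 _ = ΔDivisible-1
    last-digit 1 _ = ΔDivisible-cong (λ x → sym (ℤ.*-identityʳ (f x))) F
    last-digit (suc (suc _)) (ℕ.s≤s (ℕ.s≤s ()))

  T : (ℤ → ℤ) → ℤ → ℤ
  T f x = f x + f (x + 1ℤ)

  T^ : ℕ → (ℤ → ℤ) → ℤ → ℤ
  T^ zero    f = f
  T^ (suc N) f = T (T^ N f)

  ΔDivisible-T^ : ∀ N → ΔDivisible c s f → ΔDivisible (N ℕ.+ c) s (T^ N f)
  ΔDivisible-T^ zero    F = F
  ΔDivisible-T^ {c = c} {s = s} {f = f} (suc N) F =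
    ΔDivisible-cong T≡2*+Δ (ΔDivisible-+ (ΔDivisible-2* TF) (ΔDivisible-Δ TF))
    where
    TF : ΔDivisible (N ℕ.+ c) s (T^ N f)
    TF = ΔDivisible-T^ N F
    2v+[u-v]≡v+u : ∀ u v → + 2 * v + (u - v) ≡ v + u
    2v+[u-v]≡v+u = solve-∀
    T≡2*+Δ : ∀ x → + 2 * T^ N f x + Δ (T^ N f) x ≡ T (T^ N f) x
    T≡2*+Δ x = 2v+[u-v]≡v+u (T^ N f (x + 1ℤ)) (T^ N f x)

  ∑ : ℕ → (ℕ → ℤ) → ℤ
  ∑ zero    h = 0ℤ
  ∑ (suc m) h = h 0 + ∑ m (λ j → h (suc j))

  syntax ∑ m (λ j → e) = ∑[ j < m ] e

  ∑-cong : ∀ m {h h′ : ℕ → ℤ} → (∀ j → h j ≡ h′ j) → ∑ m h ≡ ∑ m h′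
  ∑-cong zero    h≗h′ = refl
  ∑-cong (suc m) h≗h′ = cong₂ _+_ (h≗h′ 0) (∑-cong m (λ j → h≗h′ (suc j)))

  ∑-distrib-+ : ∀ m (h h′ : ℕ → ℤ) → ∑[ j < m ] (h j + h′ j) ≡ ∑ m h + ∑ m h′
  ∑-distrib-+ zero    h h′ = refl
  ∑-distrib-+ (suc m) h h′ =
    trans (cong (_+_ (h 0 + h′ 0)) (∑-distrib-+ m (λ j → h (suc j)) (λ j → h′ (suc j))))
          (middle-four (h 0) (h′ 0) _ _)
    where
    middle-four : ∀ a b c d → (a + b) + (c + d) ≡ (a + c) + (b + d)
    middle-four = solve-∀

  *-distribˡ-∑ : ∀ m k (h : ℕ → ℤ) → k * ∑ m h ≡ ∑[ j < m ] (k * h j)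
  *-distribˡ-∑ zero    k h = ℤ.*-zeroʳ k
  *-distribˡ-∑ (suc m) k h =
    trans (ℤ.*-distribˡ-+ k (h 0) _) (cong (_+_ (k * h 0)) (*-distribˡ-∑ m k (λ j → h (suc j))))

  ∑-pad : ∀ m (h : ℕ → ℤ) → h m ≡ 0ℤ → ∑ (suc m) h ≡ ∑ m h
  ∑-pad zero    h h0≡0 = cong (_+ 0ℤ) h0≡0
  ∑-pad (suc m) h hm≡0 = cong (_+_ (h 0)) (∑-pad m (λ j → h (suc j)) hm≡0)

  ∑-binomial-pad : ∀ N (h : ℕ → ℤ) →
                   ∑[ j < suc (suc N) ] (+ (N C j) * h j) ≡ ∑[ j < suc N ] (+ (N C j) * h j)
  ∑-binomial-pad N h = ∑-pad (suc N) (λ j → + (N C j) * h j)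
    (cong (λ z → + z * h (suc N)) (k>n⇒nCk≡0 (ℕ.n<1+n N)))

  ∑-pascal : ∀ N (h : ℕ → ℤ) → ∑[ j < suc (suc N) ] (+ (suc N C j) * h j)
           ≡ ∑[ j < suc N ] (+ (N C j) * h j) + ∑[ j < suc N ] (+ (N C j) * h (suc j))
  ∑-pascal N h = begin
    h₀ + ∑[ j < suc N ] (+ (suc N C suc j) * h (suc j))
      ≡⟨ cong (_+_ h₀) (∑-cong (suc N) split) ⟩
    h₀ + ∑[ j < suc N ] (+ (N C j) * h (suc j) + + (N C suc j) * h (suc j))
      ≡⟨ cong (_+_ h₀) (∑-distrib-+ (suc N) (λ j → + (N C j) * h (suc j))
                                           (λ j → + (N C suc j) * h (suc j))) ⟩
    h₀ + (shifted + ∑[ j < suc N ] (+ (N C suc j) * h (suc j)))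
      ≡⟨ cong (λ z → h₀ + (shifted + z))
              (∑-pad N _ (cong (λ z → + z * h (suc N)) (k>n⇒nCk≡0 (ℕ.n<1+n N)))) ⟩
    h₀ + (shifted + ∑[ j < N ] (+ (N C suc j) * h (suc j)))
      ≡⟨ swap-last h₀ shifted _ ⟩
    (h₀ + ∑[ j < N ] (+ (N C suc j) * h (suc j))) + shifted
      ∎
    where
    h₀ shifted : ℤ
    h₀ = + 1 * h 0
    shifted = ∑[ j < suc N ] (+ (N C j) * h (suc j))
    split : ∀ j → + (suc N C suc j) * h (suc j) ≡ + (N C j) * h (suc j) + + (N C suc j) * h (suc j)
    split j = begin
      + (suc N C suc j) * h (suc j)
        ≡⟨ cong (λ z → + z * h (suc j)) (nCk+nC[k+1]≡[n+1]C[k+1] N j) ⟨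
      + (N C j ℕ.+ N C suc j) * h (suc j)
        ≡⟨ cong (_* h (suc j)) (ℤ.pos-+ (N C j) (N C suc j)) ⟩
      (+ (N C j) + + (N C suc j)) * h (suc j)
        ≡⟨ ℤ.*-distribʳ-+ (h (suc j)) (+ (N C j)) (+ (N C suc j)) ⟩
      + (N C j) * h (suc j) + + (N C suc j) * h (suc j)
        ∎
    swap-last : ∀ a b c → a + (b + c) ≡ (a + c) + b
    swap-last = solve-∀

  T^-expansion : ∀ N f a → T^ N f a ≡ ∑[ j < suc N ] (+ (N C j) * f (a + + j))
  T^-expansion zero f a =
    sym (trans (ℤ.+-identityʳ _) (trans (ℤ.*-identityˡ _) (cong f (ℤ.+-identityʳ a))))
  T^-expansion (suc N) f a = begin
    T^ N f a + T^ N f (a + 1ℤ)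
      ≡⟨ cong₂ _+_ (T^-expansion N f a) (T^-expansion N f (a + 1ℤ)) ⟩
    ∑[ j < suc N ] (+ (N C j) * f (a + + j)) + ∑[ j < suc N ] (+ (N C j) * f ((a + 1ℤ) + + j))
      ≡⟨ cong (_+_ (∑[ j < suc N ] (+ (N C j) * f (a + + j))))
              (∑-cong (suc N) (λ j → cong (λ y → + (N C j) * f y) (ℤ.+-assoc a 1ℤ (+ j)))) ⟩
    ∑[ j < suc N ] (+ (N C j) * f (a + + j)) + ∑[ j < suc N ] (+ (N C j) * f (a + + suc j))
      ≡⟨ ∑-pascal N (λ j → f (a + + j)) ⟨
    ∑[ j < suc (suc N) ] (+ (suc N C j) * f (a + + j))
      ∎

  -- The sums F(n,r)

  even-power : ℕ → ℤ → ℤ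
  even-power r x = (x * x) ^ r

  pos-^ : ∀ m k → + (m ℕ.^ k) ≡ (+ m) ^ k
  pos-^ m zero    = refl
  pos-^ m (suc k) = trans (ℤ.pos-* m (m ℕ.^ k)) (cong (+ m *_) (pos-^ m k))

  pos-∸ : ∀ {m n} → n ℕ.≤ m → + (m ℕ.∸ n) ≡ + m - + n
  pos-∸ {m} {n} n≤m = sym (trans (ℤ.m-n≡m⊖n m n) (ℤ.⊖-≥ n≤m))

  +dist-squared : ∀ n j → + dist n j * + dist n j ≡ (- + n + + j) * (- + n + + j)
  +dist-squared n j with ℕ.≤-total j n
  ... | inj₁ j≤n = trans (cong (λ z → z * z) +dist≡n-j) (negate-square (+ n) (+ j))
    where
    +dist≡n-j : + dist n j ≡ + n - + j
    +dist≡n-j = trans (cong +_ (trans (cong (n ℕ.∸ j ℕ.+_) (ℕ.m≤n⇒m∸n≡0 j≤n))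
                                      (ℕ.+-identityʳ (n ℕ.∸ j))))
                      (pos-∸ j≤n)
    negate-square : ∀ a b → (a - b) * (a - b) ≡ (- a + b) * (- a + b)
    negate-square = solve-∀
  ... | inj₂ n≤j = trans (cong (λ z → z * z) +dist≡j-n) (commute-square (+ n) (+ j))
    where
    +dist≡j-n : + dist n j ≡ + j - + n
    +dist≡j-n = trans (cong (λ z → + (z ℕ.+ (j ℕ.∸ n))) (ℕ.m≤n⇒m∸n≡0 n≤j)) (pos-∸ n≤j)
    commute-square : ∀ a b → (b - a) * (b - a) ≡ (- a + b) * (- a + b)
    commute-square = solve-∀

  +sum≡∑ : ∀ m (g h : ℕ → ℕ) → + sum (map h (applyUpTo g m)) ≡ ∑[ j < m ] (+ h (g j))
  +sum≡∑ zero    g h = refl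
  +sum≡∑ (suc m) g h =
    trans (ℤ.pos-+ (h (g 0)) _) (cong (_+_ (+ h (g 0))) (+sum≡∑ m (λ j → g (suc j)) h))

  +F≡∑ : ∀ n r → + F n r ≡ ∑[ j < suc (2 ℕ.* n) ] (+ (2 ℕ.* n C j) * even-power r (- + n + + j))
  +F≡∑ n r = trans (+sum≡∑ (suc (2 ℕ.* n)) id _) (∑-cong (suc (2 ℕ.* n)) term)
    where
    term : ∀ j → + ((2 ℕ.* n C j) ℕ.* dist n j ℕ.^ (2 ℕ.* r))
               ≡ + (2 ℕ.* n C j) * even-power r (- + n + + j)
    term j = trans (ℤ.pos-* (2 ℕ.* n C j) _) (cong (+ (2 ℕ.* n C j) *_) (begin
      + (dist n j ℕ.^ (2 ℕ.* r))        ≡⟨ pos-^ (dist n j) (2 ℕ.* r) ⟩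
      (+ dist n j) ^ (2 ℕ.* r)          ≡⟨ ℤ.^-*-assoc (+ dist n j) 2 r ⟨
      ((+ dist n j) ^ 2) ^ r            ≡⟨ cong (λ z → (+ dist n j * z) ^ r) (ℤ.*-identityʳ (+ dist n j)) ⟩
      (+ dist n j * + dist n j) ^ r     ≡⟨ cong (_^ r) (+dist-squared n j) ⟩
      even-power r (- + n + + j)        ∎))

  2^[2n]∣2^αr*F : ∀ n r → 2 ℕ.^ (2 ℕ.* n) ℕ∣ 2 ℕ.^ α r ℕ.* F n r
  2^[2n]∣2^αr*F n r = 2^∣2^*+⇒∣ (subst₂ (λ e y → 2^ e ∣ 2^ α r * y)
    (ℕ.+-identityʳ (2 ℕ.* n)) (trans (T^-expansion (2 ℕ.* n) (even-power r) (- + n)) (sym (+F≡∑ n r)))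
    (ΔDivisible-T^ (2 ℕ.* n) x^2r .Δ^-divisible 0 (- + n)))
    where
    x^2r : ΔDivisible 0 (α r) (even-power r)
    x^2r = ΔDivisible-^ r ℕ.≤-refl (ΔDivisible-square ΔDivisible-id)

  [1+m-k]*[1+m]Ck≡[1+m]*mCk : ∀ m k → (+ suc m - + k) * + (suc m C k) ≡ + suc m * + (m C k)
  [1+m-k]*[1+m]Ck≡[1+m]*mCk m zero    = cong (_* + 1) (ℤ.+-identityʳ (+ suc m))
  [1+m-k]*[1+m]Ck≡[1+m]*mCk m (suc k) = begin
    (a - b) * w         ≡⟨ [x-y]*z≡x*z-y*z a b w ⟩
    a * w - b * w       ≡⟨ cong₂ (λ x y → a * x - y) pascal absorb ⟩
    a * (u + v) - a * u ≡⟨ cancel a u v ⟩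
    a * v               ∎
    where
    a b w u v : ℤ
    a = + suc m
    b = + suc k
    w = + (suc m C suc k)
    u = + (m C k)
    v = + (m C suc k)
    pascal : w ≡ u + v
    pascal = trans (cong +_ (sym (nCk+nC[k+1]≡[n+1]C[k+1] m k))) (ℤ.pos-+ (m C k) (m C suc k))
    absorb : b * w ≡ a * u
    absorb = trans (sym (ℤ.pos-* (suc k) (suc m C suc k)))
               (trans (cong +_ ([1+k]*[1+n]C[1+k]≡[1+n]*nCk m k)) (ℤ.pos-* (suc m) (m C k)))
    [x-y]*z≡x*z-y*z : ∀ x y z → (x - y) * z ≡ x * z - y * z
    [x-y]*z≡x*z-y*z = solve-∀
    cancel : ∀ x y z → x * (y + z) - x * y ≡ x * z
    cancel = solve-∀

  [2+Q][1+Q]*QCi≡[1+i][1+Q-i]*[2+Q]C[1+i] : ∀ Q i →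
    + (suc (suc Q) ℕ.* suc Q) * + (Q C i) ≡ + suc i * (+ suc (suc Q) - + suc i) * + (suc (suc Q) C suc i)
  [2+Q][1+Q]*QCi≡[1+i][1+Q-i]*[2+Q]C[1+i] Q i = sym (begin
    j * (N - j) * w                     ≡⟨ rotate j (N - j) w ⟩
    (N - j) * (j * w)                   ≡⟨ cong₂ _*_ N-j≡1+Q-i absorb ⟩
    (+ suc Q - + i) * (N * w′)          ≡⟨ swap (+ suc Q - + i) N w′ ⟩
    N * ((+ suc Q - + i) * w′)          ≡⟨ cong (N *_) ([1+m-k]*[1+m]Ck≡[1+m]*mCk Q i) ⟩
    N * (+ suc Q * + (Q C i))           ≡⟨ ℤ.*-assoc N (+ suc Q) _ ⟨
    N * + suc Q * + (Q C i)             ≡⟨ cong (_* + (Q C i)) (ℤ.pos-* (suc (suc Q)) (suc Q)) ⟨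
    + (suc (suc Q) ℕ.* suc Q) * + (Q C i) ∎)
    where
    j N w w′ : ℤ
    j = + suc i
    N = + suc (suc Q)
    w = + (suc (suc Q) C suc i)
    w′ = + (suc Q C i)
    rotate : ∀ x y z → x * y * z ≡ y * (x * z)
    rotate = solve-∀
    swap : ∀ x y z → x * (y * z) ≡ y * (x * z)
    swap = solve-∀
    N-j≡1+Q-i : N - j ≡ + suc Q - + i
    N-j≡1+Q-i = trans (ℤ.m-n≡m⊖n (suc (suc Q)) (suc i))
                  (trans (ℤ.[1+m]⊖[1+n]≡m⊖n (suc Q) i) (sym (ℤ.m-n≡m⊖n (suc Q) i)))
    absorb : j * w ≡ N * w′
    absorb = trans (sym (ℤ.pos-* (suc i) (suc (suc Q) C suc i)))
               (trans (cong +_ ([1+k]*[1+n]C[1+k]≡[1+n]*nCk (suc Q) i)) (ℤ.pos-* (suc (suc Q)) (suc Q C i)))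

  -- Termwise, with N = 2n: (j - n)² + j(N - j) = n² and j(N - j)·C(N,j) = N(N - 1)·C(N - 2, j - 1).
  ∑-recurrence : ∀ Q n (y : ℕ → ℤ) → n ℕ.+ n ≡ suc (suc Q) →
      ∑[ j < suc (suc (suc Q)) ] (+ (suc (suc Q) C j) * (((- + n + + j) * (- + n + + j)) * y j))
    + + (suc (suc Q) ℕ.* suc Q) * ∑[ i < suc Q ] (+ (Q C i) * y (suc i))
    ≡ (+ n * + n) * ∑[ j < suc (suc (suc Q)) ] (+ (suc (suc Q) C j) * y j)
  ∑-recurrence Q n y n+n≡2+Q = begin
    ∑[ j < 3+Q ] (w j * (x² j * y j)) + K * ∑[ i < suc Q ] (+ (Q C i) * y (suc i))
      ≡⟨ cong (λ z → ∑[ j < 3+Q ] (w j * (x² j * y j)) + K * z) reindex ⟩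
    ∑[ j < 3+Q ] (w j * (x² j * y j)) + K * ∑[ j < 3+Q ] (b j * y j)
      ≡⟨ cong (_+_ (∑[ j < 3+Q ] (w j * (x² j * y j)))) (*-distribˡ-∑ 3+Q K (λ j → b j * y j)) ⟩
    ∑[ j < 3+Q ] (w j * (x² j * y j)) + ∑[ j < 3+Q ] (K * (b j * y j))
      ≡⟨ ∑-distrib-+ 3+Q (λ j → w j * (x² j * y j)) (λ j → K * (b j * y j)) ⟨
    ∑[ j < 3+Q ] (w j * (x² j * y j) + K * (b j * y j))
      ≡⟨ ∑-cong 3+Q term ⟩
    ∑[ j < 3+Q ] ((+ n * + n) * (w j * y j))
      ≡⟨ *-distribˡ-∑ 3+Q (+ n * + n) (λ j → w j * y j) ⟨
    (+ n * + n) * ∑[ j < 3+Q ] (w j * y j)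
      ∎
    where
    3+Q : ℕ
    3+Q = suc (suc (suc Q))
    K : ℤ
    K = + (suc (suc Q) ℕ.* suc Q)
    w x² b : ℕ → ℤ
    w j = + (suc (suc Q) C j)
    x² j = (- + n + + j) * (- + n + + j)
    b zero    = 0ℤ
    b (suc i) = + (Q C i)
    reindex : ∑[ i < suc Q ] (+ (Q C i) * y (suc i)) ≡ ∑[ j < 3+Q ] (b j * y j)
    reindex = sym (trans (cong (_+ ∑[ i < suc (suc Q) ] (+ (Q C i) * y (suc i))) (ℤ.*-zeroˡ (y 0)))
                  (trans (ℤ.+-identityˡ _) (∑-binomial-pad Q (λ i → y (suc i)))))
    at-zero : ∀ m k → + 1 * ((- m + + 0) * (- m + + 0)) + k * 0ℤ ≡ (m * m) * + 1
    at-zero = solve-∀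
    completing-square : ∀ c m j → c * ((- m + j) * (- m + j)) + j * ((m + m) - j) * c ≡ (m * m) * c
    completing-square = solve-∀
    key : ∀ j → w j * x² j + K * b j ≡ (+ n * + n) * w j
    key zero    = at-zero (+ n) K
    key (suc i) = begin
      w (suc i) * x² (suc i) + K * + (Q C i)
        ≡⟨ cong (_+_ (w (suc i) * x² (suc i))) ([2+Q][1+Q]*QCi≡[1+i][1+Q-i]*[2+Q]C[1+i] Q i) ⟩
      w (suc i) * x² (suc i) + + suc i * (+ suc (suc Q) - + suc i) * w (suc i)
        ≡⟨ cong (λ N → w (suc i) * x² (suc i) + + suc i * (N - + suc i) * w (suc i))
                (trans (cong +_ (sym n+n≡2+Q)) (ℤ.pos-+ n n)) ⟩
      w (suc i) * x² (suc i) + + suc i * ((+ n + + n) - + suc i) * w (suc i)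
        ≡⟨ completing-square (w (suc i)) (+ n) (+ suc i) ⟩
      (+ n * + n) * w (suc i)
        ∎
    factor : ∀ c X k b y → c * (X * y) + k * (b * y) ≡ (c * X + k * b) * y
    factor = solve-∀
    term : ∀ j → w j * (x² j * y j) + K * (b j * y j) ≡ (+ n * + n) * (w j * y j)
    term j = trans (factor (w j) (x² j) K (b j) (y j))
               (trans (cong (_* y j) (key j)) (ℤ.*-assoc (+ n * + n) (w j) (y j)))

  F-recurrence : ∀ p r →
    F (suc p) (suc r) ℕ.+ 2 ℕ.* suc p ℕ.* suc (2 ℕ.* p) ℕ.* F p r ≡ suc p ℕ.* suc p ℕ.* F (suc p) r
  F-recurrence p r = ℤ.+-injective (begin
    + (F n (suc r) ℕ.+ 2 ℕ.* n ℕ.* suc Q ℕ.* F p r)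
      ≡⟨ ℤ.pos-+ (F n (suc r)) _ ⟩
    + F n (suc r) + + (2 ℕ.* n ℕ.* suc Q ℕ.* F p r)
      ≡⟨ cong (_+_ (+ F n (suc r))) (ℤ.pos-* (2 ℕ.* n ℕ.* suc Q) (F p r)) ⟩
    + F n (suc r) + + (2 ℕ.* n ℕ.* suc Q) * + F p r
      ≡⟨ cong₂ (λ u v → u + + (v ℕ.* suc Q) * + F p r) (+F[n]≡∑ (suc r)) (ℕ.*-suc 2 p) ⟩
    ∑x²y + + (suc (suc Q) ℕ.* suc Q) * + F p r
      ≡⟨ cong (λ z → ∑x²y + + (suc (suc Q) ℕ.* suc Q) * z) +F[p]≡∑ ⟩
    ∑x²y + + (suc (suc Q) ℕ.* suc Q) * ∑[ i < suc Q ] (+ (Q C i) * y (suc i))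
      ≡⟨ ∑-recurrence Q n y n+n≡2+Q ⟩
    (+ n * + n) * ∑[ j < suc (suc (suc Q)) ] (+ (suc (suc Q) C j) * y j)
      ≡⟨ cong₂ _*_ (ℤ.pos-* n n) (+F[n]≡∑ r) ⟨
    + (n ℕ.* n) * + F n r
      ≡⟨ ℤ.pos-* (n ℕ.* n) (F n r) ⟨
    + (n ℕ.* n ℕ.* F n r)
      ∎)
    where
    n Q : ℕ
    n = suc p
    Q = 2 ℕ.* p
    y : ℕ → ℤ
    y j = even-power r (- + n + + j)
    ∑x²y : ℤ
    ∑x²y = ∑[ j < suc (suc (suc Q)) ] (+ (suc (suc Q) C j) * (((- + n + + j) * (- + n + + j)) * y j))
    n+n≡2+Q : n ℕ.+ n ≡ suc (suc Q)
    n+n≡2+Q = trans (cong (n ℕ.+_) (sym (ℕ.+-identityʳ n))) (ℕ.*-suc 2 p)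
    +F[n]≡∑ : ∀ r′ →
      + F n r′ ≡ ∑[ j < suc (suc (suc Q)) ] (+ (suc (suc Q) C j) * even-power r′ (- + n + + j))
    +F[n]≡∑ r′ = trans (+F≡∑ n r′)
      (cong (λ N → ∑[ j < suc N ] (+ (N C j) * even-power r′ (- + n + + j))) (ℕ.*-suc 2 p))
    shift : ∀ a i → - a + i ≡ - (+ 1 + a) + (+ 1 + i)
    shift = solve-∀
    +F[p]≡∑ : + F p r ≡ ∑[ i < suc Q ] (+ (Q C i) * y (suc i))
    +F[p]≡∑ = trans (+F≡∑ p r) (∑-cong (suc Q) (λ i → cong (λ x → + (Q C i) * even-power r x)
      (trans (shift (+ p) (+ i)) (cong₂ (λ u v → - u + v) (sym (ℤ.pos-+ 1 p)) (sym (ℤ.pos-+ 1 i))))))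

-- The bound with α(n)

open import Data.Nat.Base using (_+_; _*_; _∸_; _⊓_; _^_)
open import Data.Nat.Properties
  using ( ≤-total; ⊓-sel; +-comm; *-suc; *-identityˡ; *-distribˡ-+; ^-distribˡ-+-*
        ; m^n≢0; m+[n∸m]≡n; m≤n⇒m∸n≡0)
open import Data.Nat.Divisibility
  using (_∣_; 1∣_; ∣n⇒∣m*n; ∣m+n∣m⇒∣n; *-monoʳ-∣; *-pres-∣; *-cancelˡ-∣)
open import Data.Nat.Tactic.RingSolver using (solve-∀)

2^a∣2^b*x⇒2^[a∸b]∣x : ∀ a b x → 2 ^ a ∣ 2 ^ b * x → 2 ^ (a ∸ b) ∣ x
2^a∣2^b*x⇒2^[a∸b]∣x a b x 2^a∣2^b*x with ≤-total b a
... | inj₁ b≤a = *-cancelˡ-∣ (2 ^ b) {{m^n≢0 2 b}} (subst (_∣ 2 ^ b * x) 2^a≡2^b*2^[a∸b] 2^a∣2^b*x)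
  where
  2^a≡2^b*2^[a∸b] : 2 ^ a ≡ 2 ^ b * 2 ^ (a ∸ b)
  2^a≡2^b*2^[a∸b] = trans (cong (2 ^_) (sym (m+[n∸m]≡n b≤a))) (^-distribˡ-+-* 2 b (a ∸ b))
... | inj₂ a≤b = subst (λ e → 2 ^ e ∣ x) (sym (m≤n⇒m∸n≡0 a≤b)) (1∣ x)

2^[2n]∣2^αn*F : ∀ n r → 2 ^ (2 * n) ∣ 2 ^ α n * F n r
2^[2n]∣2^αn*F n       zero    =
  ∣n⇒∣m*n (2 ^ α n) (subst (2 ^ (2 * n) ∣_) (*-identityˡ (F n 0)) (2^[2n]∣2^αr*F n 0))
2^[2n]∣2^αn*F zero    (suc r) = 1∣ _
2^[2n]∣2^αn*F (suc p) (suc r) = ∣m+n∣m⇒∣n (subst (2 ^ (2 * n) ∣_) (sym recurrence) first) second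
  where
  n s A : ℕ
  n = suc p
  s = suc (2 * p)
  A = 2 ^ α n
  recurrence : A * (2 * n * s * F p r) + A * F n (suc r) ≡ A * (n * n * F n r)
  recurrence = trans (+-comm (A * (2 * n * s * F p r)) _)
    (trans (sym (*-distribˡ-+ A (F n (suc r)) _)) (cong (A *_) (F-recurrence p r)))
  swap : ∀ a b c → b * (a * c) ≡ a * (b * c)
  swap = solve-∀
  first : 2 ^ (2 * n) ∣ A * (n * n * F n r)
  first = subst (2 ^ (2 * n) ∣_) (swap A (n * n) (F n r)) (∣n⇒∣m*n (n * n) (2^[2n]∣2^αn*F n r))
  shift-2 : ∀ a b → 2 * a * b ≡ a * (2 * b)
  shift-2 = solve-∀
  pull-out : ∀ A n a f → A * n * (a * f) ≡ a * (A * n * f)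
  pull-out = solve-∀
  halved : 2 * 2 ^ (2 * p) ∣ A * n * F p r
  halved = *-cancelˡ-∣ (2 ^ α p) {{m^n≢0 2 (α p)}}
    (subst₂ _∣_ (shift-2 (2 ^ α p) (2 ^ (2 * p))) (pull-out A n (2 ^ α p) (F p r))
      (*-pres-∣ (2^[1+αn]∣2^α[1+n]*[1+n] p) (2^[2n]∣2^αn*F p r)))
  spread : ∀ A n s f → s * (2 * (A * n * f)) ≡ A * (2 * n * s * f)
  spread = solve-∀
  second : 2 ^ (2 * n) ∣ A * (2 * n * s * F p r)
  second = subst₂ _∣_ (cong (2 ^_) (sym (*-suc 2 p))) (spread A n s (F p r))
    (∣n⇒∣m*n s (*-monoʳ-∣ 2 halved))

theorem1p1 : (n r : ℕ) → ν₂≥ (F n r) (2 * n ∸ (α n ⊓ α r))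
theorem1p1 n r = 2^a∣2^b*x⇒2^[a∸b]∣x (2 * n) (α n ⊓ α r) (F n r) smaller-weight
  where
  smaller-weight : 2 ^ (2 * n) ∣ 2 ^ (α n ⊓ α r) * F n r
  smaller-weight with ⊓-sel (α n) (α r)
  ... | inj₁ ⊓≡αn = subst (λ e → 2 ^ (2 * n) ∣ 2 ^ e * F n r) (sym ⊓≡αn) (2^[2n]∣2^αn*F n r)
  ... | inj₂ ⊓≡αr = subst (λ e → 2 ^ (2 * n) ∣ 2 ^ e * F n r) (sym ⊓≡αr) (2^[2n]∣2^αr*F n r)
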